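{- For every integer $t\geqslant 1$, $$\kappa^{(1)}(EH(1,t))=\lambda^{(1)}(EH(1,t))=2.$$
   Context: For integers $s,t\geqslant 1$, the exchanged hypercube $EH(s,t)$ is the graph whose vertices are the binary strings $u=u_{s+t}\cdots u_1u_0$ of length $s+t+1$. Two vertices $u,v$ are adjacent if and only if one of the following three conditions holds: (i) $u$ and $v$ differ exactly in the last bit $u_0$; (ii) $u$ and $v$ differ in exactly one bit $u_r$ with $1\leqslant r\leqslant t$, and $u_0=v_0=1$; (iii) $u$ and $v$ differ in exactly one bit $u_r$ with $t+1\leqslant r\leqslant s+t$, and $u_0=v_0=0$. For a connected graph $G$: - A vertex subset $S\subset V(G)$ is a $1$-vertex-cut if $G-S$ is disconnected and has minimum degree at least $1$. - An edge subset $F\subset E(G)$ is a $1$-edge-cut if $G-F$ is disconnected and has minimum degree at least $1$. - $\kappa^{(1)}(G)$ is the minimum cardinality of a $1$-vertex-cut of $G$. - $\lambda^{(1)}(G)$ is the minimum cardinality of a $1$-edge-cut of $G$. -}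

module Defs where

open import Data.Nat using (ℕ; zero; suc; _+_; _≤_)
open import Data.Fin using (Fin; toℕ)
import Data.Fin as F
open import Data.Bool using (Bool; true; false)
open import Data.Vec using (Vec; lookup)
open import Data.List using (List; length)
open import Data.List.Membership.Propositional using (_∉_)
open import Data.List.Relation.Unary.All using (All)
open import Data.List.Relation.Unary.Unique.Propositional using (Unique)
open import Data.List.Relation.Unary.AllPairs using (AllPairs)
open import Data.Product using (Σ; _×_; _,_; ∃)
open import Data.Sum using (_⊎_)
open import Relation.Nullary using (¬_)
open import Relation.Binary.PropositionalEquality using (_≡_; _≢_)

data Walk {V : Set} (A : V → V → Set) : V → V → Set where
  here : ∀ {u} → Walk A u u
  step : ∀ {u v w} → A u v → Walk A v w → Walk A u w

AdjMinusV : {V : Set} → (V → V → Set) → List V → V → V → Set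
AdjMinusV Adj S u v = (u ∉ S) × (v ∉ S) × Adj u v

-- G - F (F a list of edges, given as ordered pairs, read unordered).
AdjMinusE : {V : Set} → (V → V → Set) → List (V × V) → V → V → Set
AdjMinusE Adj F u v = Adj u v × ((u , v) ∉ F) × ((v , u) ∉ F)

Is1VertexCut : {V : Set} → (V → V → Set) → List V → Set
Is1VertexCut {V} Adj S =
  Unique S
  × (Σ V λ u → Σ V λ v → (u ∉ S) × (v ∉ S) × ¬ Walk (AdjMinusV Adj S) u v)
  × (∀ u → u ∉ S → Σ V λ v → AdjMinusV Adj S u v)

DistinctEdges : {V : Set} → V × V → V × V → Set
DistinctEdges (a , b) (c , d) = ¬ (a ≡ c × b ≡ d) × ¬ (a ≡ d × b ≡ c)

Is1EdgeCut : {V : Set} → (V → V → Set) → List (V × V) → Set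
Is1EdgeCut {V} Adj F =
  All (λ e → Adj (Data.Product.proj₁ e) (Data.Product.proj₂ e)) F
  × AllPairs DistinctEdges F
  × (Σ V λ u → Σ V λ v → ¬ Walk (AdjMinusE Adj F) u v)
  × (∀ u → Σ V λ v → AdjMinusE Adj F u v)

IsMinCard : {X : Set} → (List X → Set) → ℕ → Set
IsMinCard {X} P k =
  (Σ (List X) λ S → P S × length S ≡ k) × (∀ S → P S → k ≤ length S)

Kappa1≡ : {V : Set} → (V → V → Set) → ℕ → Set
Kappa1≡ Adj k = IsMinCard (Is1VertexCut Adj) k

Lambda1≡ : {V : Set} → (V → V → Set) → ℕ → Set
Lambda1≡ Adj k = IsMinCard (Is1EdgeCut Adj) k

-- Exchanged hypercube EH(s,t).
-- A vertex u = u_{s+t} ⋯ u_1 u_0 is a vector of s+t+1 bits, where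
-- bit u_r is  lookup u r  (r : Fin (s+t+1), r read via toℕ).

EHVertex : ℕ → ℕ → Set
EHVertex s t = Vec Bool (suc (s + t))

DiffExactlyAt : ∀ {n} → Vec Bool n → Vec Bool n → Fin n → Set
DiffExactlyAt {n} u v r =
  (lookup u r ≢ lookup v r) × (∀ (j : Fin n) → j ≢ r → lookup u j ≡ lookup v j)

EHAdj : (s t : ℕ) → EHVertex s t → EHVertex s t → Set
EHAdj s t u v =
  DiffExactlyAt u v F.zero
  ⊎ (Σ (Fin (suc (s + t))) λ r →
        1 ≤ toℕ r × toℕ r ≤ t × DiffExactlyAt u v r
        × lookup u F.zero ≡ true × lookup v F.zero ≡ true)
  ⊎ (Σ (Fin (suc (s + t))) λ r →
        suc t ≤ toℕ r × toℕ r ≤ s + t × DiffExactlyAt u v r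
        × lookup u F.zero ≡ false × lookup v F.zero ≡ false)

-- EH(1,t) is 2-connected: write a vertex as (u_{t+1}, x, u₀) with x = u_t ⋯ u₁.  For each
-- Boolean b the vertices (b, x, 1) form a connected copy of Q_t, a deleted vertex can damage
-- at most one of these two cubes, and they stay joined through the rungs
-- (b,x,1) — (b,x,0) — (¬b,x,0) — (¬b,x,1), of which at most one meets the deleted vertex.
-- As every vertex also has two neighbours, deleting one edge cannot disconnect the graph
-- either.  Conversely the edge {0⋯0, 10⋯0} on the u₀ = 0 side has exactly two further
-- neighbours, both along bit 0; deleting them (or the two bit-0 edges) leaves it as a K₂
-- component.
module Submission where

open import Defs
open import Data.Nat using (ℕ; _≤_)
open import Data.Product using (_×_)

open import Data.Nat using (suc; z≤n; s≤s; _≤?_)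
open import Data.Nat.Properties using (≤-refl; ≤-antisym; ≤-pred; ≰⇒>; 1+n≰n)
open import Data.Fin using (Fin; toℕ; fromℕ)
import Data.Fin as Fin
open import Data.Fin.Properties using (toℕ-injective; toℕ<n; toℕ-fromℕ)
open import Data.Bool using (Bool; true; false; not)
open import Data.Bool.Properties using (not-¬; ¬-not; not-involutive) renaming (_≟_ to _≟ᵇ_)
open import Data.Vec using (Vec; []; _∷_; lookup; updateAt; replicate)
open import Data.Vec.Properties
  using (lookup∘updateAt; lookup∘updateAt′; updateAt-updateAt-local; updateAt-id; lookup-replicate;
         tabulate∘lookup; tabulate-cong; ≡-dec)
open import Data.List using (List; []; _∷_; length)
open import Data.List.Relation.Unary.Any using (here; there)
open import Data.List.Membership.Propositional using (_∈_; _∉_)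
open import Data.List.Relation.Unary.All using ([]; _∷_)
open import Data.List.Relation.Unary.AllPairs using ([]; _∷_)
open import Data.Product using (Σ; _,_; proj₁; proj₂)
open import Data.Sum using (_⊎_; inj₁; inj₂)
open import Data.Empty using (⊥-elim)
open import Function using (id; _∘_)
open import Relation.Nullary using (¬_; Dec; yes; no)
open import Relation.Nullary.Decidable using (_×-dec_)
open import Relation.Binary.Definitions using (DecidableEquality)
open import Relation.Binary.PropositionalEquality
  using (_≡_; _≢_; refl; sym; trans; cong; subst)

module _ {V : Set} {A : V → V → Set} where

  infixr 5 _++ʷ_
  _++ʷ_ : ∀ {u v w} → Walk A u v → Walk A v w → Walk A u w
  here     ++ʷ q = q
  step e p ++ʷ q = step e (p ++ʷ q)

  edgeʷ : ∀ {u v} → A u v → Walk A u v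
  edgeʷ e = step e here

  reverseʷ : (∀ {x y} → A x y → A y x) → ∀ {u v} → Walk A u v → Walk A v u
  reverseʷ sym-A here       = here
  reverseʷ sym-A (step e p) = reverseʷ sym-A p ++ʷ edgeʷ (sym-A e)

  walk-preserves : (P : V → Set) → (∀ {x y} → P x → A x y → P y) →
                   ∀ {u v} → Walk A u v → P u → P v
  walk-preserves P closed here       pu = pu
  walk-preserves P closed (step e p) pu = walk-preserves P closed p (closed pu e)

mapʷ : ∀ {V W : Set} {A : V → V → Set} {B : W → W → Set} (f : V → W) →
       (∀ {x y} → A x y → B (f x) (f y)) → ∀ {u v} → Walk A u v → Walk B (f u) (f v)
mapʷ f g here       = here
mapʷ f g (step e p) = step (g e) (mapʷ f g p)

module TwoConnected {V : Set} (Adj : V → V → Set)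
  (_≟_ : DecidableEquality V)
  (Adj-sym : ∀ {x y} → Adj x y → Adj y x)
  (Adj-irrefl : ∀ {x y} → Adj x y → x ≢ y)
  (two-neighbours : ∀ a → Σ V λ b → Σ V λ c → Adj a b × Adj a c × b ≢ c)
  (connected-minus-vertex :
     ∀ a {u v} → u ≢ a → v ≢ a → Walk (AdjMinusV Adj (a ∷ [])) u v)
  where

  connected-minus-edge : ∀ p q u v → Walk (AdjMinusE Adj ((p , q) ∷ [])) u v
  connected-minus-edge p q u v = reach u ++ʷ reverseʷ sym-E (reach v)
    where
    E : V → V → Set
    E = AdjMinusE Adj ((p , q) ∷ [])

    sym-E : ∀ {x y} → E x y → E y x
    sym-E (e , xy∉ , yx∉) = Adj-sym e , yx∉ , xy∉

    avoid : ∀ {x y} → AdjMinusV Adj (p ∷ []) x y → E x y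
    avoid (x∉ , y∉ , e) = e , (λ { (here eq) → x∉ (here (cong proj₁ eq)) ; (there ()) })
                            , (λ { (here eq) → y∉ (here (cong proj₁ eq)) ; (there ()) })

    neighbour≢q : Σ V λ z → Adj p z × z ≢ q
    neighbour≢q with two-neighbours p
    ... | b , c , pb , pc , b≢c with b ≟ q
    ...   | no b≢q  = b , pb , b≢q
    ...   | yes b≡q = c , pc , λ c≡q → b≢c (trans b≡q (sym c≡q))

    z : V
    z = proj₁ neighbour≢q

    reach : ∀ w → Walk E w z
    reach w with w ≟ p | neighbour≢q
    ... | yes refl | _ , pz , z≢q =
      edgeʷ (pz , (λ { (here eq) → z≢q (cong proj₂ eq) ; (there ()) })
                , (λ { (here eq) → Adj-irrefl pz (sym (cong proj₁ eq)) ; (there ()) }))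
    ... | no w≢p   | _ , pz , _ =
      mapʷ id avoid (connected-minus-vertex p w≢p (Adj-irrefl pz ∘ sym))

  connected : ∀ u v → Walk Adj u v
  connected u v = mapʷ id proj₁ (connected-minus-edge u u u v)

  1-vertex-cut-size : ∀ S → Is1VertexCut Adj S → 2 ≤ length S
  1-vertex-cut-size [] (_ , (u , v , _ , _ , no-walk) , _) =
    ⊥-elim (no-walk (mapʷ id (λ e → (λ ()) , (λ ()) , e) (connected u v)))
  1-vertex-cut-size (a ∷ []) (_ , (u , v , u∉ , v∉ , no-walk) , _) =
    ⊥-elim (no-walk (connected-minus-vertex a (u∉ ∘ here) (v∉ ∘ here)))
  1-vertex-cut-size (_ ∷ _ ∷ _) _ = s≤s (s≤s z≤n)

  1-edge-cut-size : ∀ F → Is1EdgeCut Adj F → 2 ≤ length F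
  1-edge-cut-size [] (_ , _ , (u , v , no-walk) , _) =
    ⊥-elim (no-walk (mapʷ id (λ e → e , (λ ()) , (λ ())) (connected u v)))
  1-edge-cut-size ((p , q) ∷ []) (_ , _ , (u , v , no-walk) , _) =
    ⊥-elim (no-walk (connected-minus-edge p q u v))
  1-edge-cut-size (_ ∷ _ ∷ _) _ = s≤s (s≤s z≤n)

flip : ∀ {n} → Vec Bool n → Fin n → Vec Bool n
flip u r = updateAt u r not

module _ {n : ℕ} where

  lookup-flip : ∀ (u : Vec Bool n) r → lookup (flip u r) r ≡ not (lookup u r)
  lookup-flip u r = lookup∘updateAt r u

  lookup-flip′ : ∀ (u : Vec Bool n) {j r} → j ≢ r → lookup (flip u r) j ≡ lookup u j
  lookup-flip′ u {j} {r} j≢r = lookup∘updateAt′ j r j≢r u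

  flip-involutive : ∀ (u : Vec Bool n) r → flip (flip u r) r ≡ u
  flip-involutive u r =
    trans (updateAt-updateAt-local r u (not-involutive (lookup u r))) (updateAt-id r u)

  lookup-extensionality : ∀ {u v : Vec Bool n} → (∀ i → lookup u i ≡ lookup v i) → u ≡ v
  lookup-extensionality {u} {v} eq =
    trans (sym (tabulate∘lookup u)) (trans (tabulate-cong eq) (tabulate∘lookup v))

  ≢-at : ∀ {u v : Vec Bool n} j → lookup u j ≢ lookup v j → u ≢ v
  ≢-at j ne refl = ne refl

  diff-flip : ∀ (u : Vec Bool n) r → DiffExactlyAt u (flip u r) r
  diff-flip u r =
    (λ eq → not-¬ refl (trans eq (lookup-flip u r))) , λ j j≢r → sym (lookup-flip′ u j≢r)

  flip-≢ : ∀ (u : Vec Bool n) r → flip u r ≢ u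
  flip-≢ u r = ≢-at r (proj₁ (diff-flip u r) ∘ sym)

  diff⇒flip : ∀ {u v : Vec Bool n} {r} → DiffExactlyAt u v r → v ≡ flip u r
  diff⇒flip {u} {v} {r} (u≢v , agree) = lookup-extensionality at
    where
    at : ∀ j → lookup v j ≡ lookup (flip u r) j
    at j with j Fin.≟ r
    ... | yes refl = trans (¬-not (u≢v ∘ sym)) (sym (lookup-flip u r))
    ... | no j≢r   = trans (sym (agree j j≢r)) (sym (lookup-flip′ u j≢r))

flips-walk : ∀ {n} (A : Vec Bool n → Vec Bool n → Set) {D : Fin n → Set} →
             (∀ r → Dec (D r)) → (P : Vec Bool n → Set) →
             (∀ {x r} → P x → D r → P (flip x r) × A x (flip x r)) →
             ∀ {u v} → P u → (∀ r → ¬ D r → lookup u r ≡ lookup v r) → Walk A u v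
flips-walk A D? P flip-step {[]}    {[]}    _  _     = here
flips-walk A {D} D? P flip-step {a ∷ u} {b ∷ v} pu agree = head-then-tail (a ≟ᵇ b) (D? Fin.zero)
  where
  tail-walk : ∀ {c} → P (c ∷ u) → Walk A (c ∷ u) (c ∷ v)
  tail-walk {c} pc = mapʷ (c ∷_) id
    (flips-walk (λ x y → A (c ∷ x) (c ∷ y)) (D? ∘ Fin.suc) (P ∘ (c ∷_)) flip-step pc (agree ∘ Fin.suc))

  head-then-tail : Dec (a ≡ b) → Dec (D Fin.zero) → Walk A (a ∷ u) (b ∷ v)
  head-then-tail (yes a≡b) _      = subst (λ c → Walk A (a ∷ u) (c ∷ v)) a≡b (tail-walk pu)
  head-then-tail (no a≢b)  (no ¬d) = ⊥-elim (a≢b (agree Fin.zero ¬d))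
  head-then-tail (no a≢b)  (yes d) =
    step (proj₂ (flip-step pu d))
         (subst (λ c → Walk A (not a ∷ u) (c ∷ v)) (sym (¬-not (a≢b ∘ sym))) (tail-walk (proj₁ (flip-step pu d))))

module EH₁ (m : ℕ) where

  V : Set
  V = EHVertex 1 (suc m)

  G : V → V → Set
  G = EHAdj 1 (suc m)

  Index : Set
  Index = Fin (suc (suc (suc m)))

  -- The positions of u₀, u₁ and u_{t+1}; u₁ … u_t are the Middle bits.
  i0 i1 iL : Index
  i0 = Fin.zero
  i1 = Fin.suc Fin.zero
  iL = fromℕ (suc (suc m))

  Middle : Index → Set
  Middle r = 1 ≤ toℕ r × toℕ r ≤ suc m

  middle? : ∀ r → Dec (Middle r)
  middle? r = 1 ≤? toℕ r ×-dec toℕ r ≤? suc m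

  middle-i1 : Middle i1
  middle-i1 = s≤s z≤n , s≤s z≤n

  toℕ-iL : toℕ iL ≡ suc (suc m)
  toℕ-iL = toℕ-fromℕ (suc (suc m))

  toℕ⇒iL : ∀ {r} → toℕ r ≡ suc (suc m) → r ≡ iL
  toℕ⇒iL eq = toℕ-injective (trans eq (sym toℕ-iL))

  middle≢i0 : ∀ {r} → Middle r → r ≢ i0
  middle≢i0 (() , _) refl

  middle≢iL : ∀ {r} → Middle r → r ≢ iL
  middle≢iL (_ , r≤t) refl = 1+n≰n (subst (_≤ suc m) toℕ-iL r≤t)

  not-middle : ∀ r → ¬ Middle r → r ≡ i0 ⊎ r ≡ iL
  not-middle Fin.zero    _    = inj₁ refl
  not-middle (Fin.suc r) ¬mid = inj₂ (toℕ⇒iL (≤-antisym (≤-pred (toℕ<n (Fin.suc r)))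
                                                          (≰⇒> (λ r≤t → ¬mid (s≤s z≤n , r≤t)))))

  bit0-cases : ∀ (u : V) → lookup u i0 ≡ true ⊎ lookup u i0 ≡ false
  bit0-cases u with lookup u i0
  ... | true  = inj₁ refl
  ... | false = inj₂ refl

  flip₀-adj : ∀ u → G u (flip u i0)
  flip₀-adj u = inj₁ (diff-flip u i0)

  middle-adj : ∀ {r} u → Middle r → lookup u i0 ≡ true → G u (flip u r)
  middle-adj u mid@(1≤r , r≤t) u₀ =
    inj₂ (inj₁ (_ , 1≤r , r≤t , diff-flip u _ , u₀ , trans (lookup-flip′ u (middle≢i0 mid ∘ sym)) u₀))

  flipL-adj : ∀ u → lookup u i0 ≡ false → G u (flip u iL)
  flipL-adj u u₀ = inj₂ (inj₂ (iL , subst (suc (suc m) ≤_) (sym toℕ-iL) ≤-refl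
                                   , subst (_≤ suc (suc m)) (sym toℕ-iL) ≤-refl
                                   , diff-flip u iL , u₀ , trans (lookup-flip′ u (λ ())) u₀))

  diff-sym : ∀ {u v : V} {r} → DiffExactlyAt u v r → DiffExactlyAt v u r
  diff-sym (u≢v , agree) = u≢v ∘ sym , λ j j≢r → sym (agree j j≢r)

  G-sym : ∀ {u v} → G u v → G v u
  G-sym {u} {v} (inj₁ d)                                = inj₁ (diff-sym {u} {v} d)
  G-sym {u} {v} (inj₂ (inj₁ (r , p , q , d , u₀ , v₀))) = inj₂ (inj₁ (r , p , q , diff-sym {u} {v} d , v₀ , u₀))
  G-sym {u} {v} (inj₂ (inj₂ (r , p , q , d , u₀ , v₀))) = inj₂ (inj₂ (r , p , q , diff-sym {u} {v} d , v₀ , u₀))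

  G-irrefl : ∀ {u v} → G u v → u ≢ v
  G-irrefl (inj₁ (u≢v , _))                          = ≢-at i0 u≢v
  G-irrefl (inj₂ (inj₁ (r , _ , _ , (u≢v , _) , _))) = ≢-at r u≢v
  G-irrefl (inj₂ (inj₂ (r , _ , _ , (u≢v , _) , _))) = ≢-at r u≢v

  matching-side-neighbours : ∀ {u w} → lookup u i0 ≡ false → G u w → w ≡ flip u i0 ⊎ w ≡ flip u iL
  matching-side-neighbours u₀ (inj₁ d) = inj₁ (diff⇒flip d)
  matching-side-neighbours u₀ (inj₂ (inj₁ (_ , _ , _ , _ , u₀′ , _))) with trans (sym u₀) u₀′
  ... | ()
  matching-side-neighbours u₀ (inj₂ (inj₂ (r , t<r , r≤t+1 , d , _))) with toℕ⇒iL (≤-antisym r≤t+1 t<r)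
  ... | refl = inj₂ (diff⇒flip d)

  flip₀-≢-flip : ∀ u {r} → r ≢ i0 → flip u i0 ≢ flip u r
  flip₀-≢-flip u r≢0 = ≢-at i0 λ eq →
    not-¬ refl (sym (trans (sym (lookup-flip u i0)) (trans eq (lookup-flip′ u (r≢0 ∘ sym)))))

  two-neighbours : ∀ a → Σ V λ b → Σ V λ c → G a b × G a c × b ≢ c
  two-neighbours a with bit0-cases a
  ... | inj₁ a₀ = flip a i0 , flip a i1 , flip₀-adj a , middle-adj a middle-i1 a₀ , flip₀-≢-flip a (λ ())
  ... | inj₂ a₀ = flip a i0 , flip a iL , flip₀-adj a , flipL-adj a a₀ , flip₀-≢-flip a (λ ())

  false≢true : false ≢ true
  false≢true ()

  -- The vertices with u₀ = 0 are matched in pairs by bit u_{t+1}; those with u₀ = 1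
  -- split according to u_{t+1} into two copies of Q_t.
  record Cube (b : Bool) (x : V) : Set where
    constructor cube
    field
      bit₀ : lookup x i0 ≡ true
      bitL : lookup x iL ≡ b

  flip₀-cube : ∀ w → lookup w i0 ≡ false → Cube (lookup w iL) (flip w i0)
  flip₀-cube w w₀ = cube (trans (lookup-flip w i0) (cong not w₀)) (lookup-flip′ w (λ ()))

  middle-flip-cube : ∀ {b x r} → Middle r → Cube b x → Cube b (flip x r)
  middle-flip-cube {x = x} mid (cube x₀ xL) =
    cube (trans (lookup-flip′ x (middle≢i0 mid ∘ sym)) x₀) (trans (lookup-flip′ x (middle≢iL mid ∘ sym)) xL)

  across : V → V
  across y = flip (flip (flip y i0) iL) i0

  across-cube : ∀ {b y} → Cube b y → Cube (not b) (across y)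
  across-cube {y = y} (cube y₀ yL) =
    cube (trans (lookup-flip (flip (flip y i0) iL) i0)
                (cong not (trans (lookup-flip′ (flip y i0) (λ ())) (trans (lookup-flip y i0) (cong not y₀)))))
         (trans (lookup-flip′ (flip (flip y i0) iL) (λ ()))
                (trans (lookup-flip (flip y i0) iL) (cong not (trans (lookup-flip′ y (λ ())) yL))))

  module Avoiding (a : V) where

    _⇝_ : V → V → Set
    _⇝_ = Walk (AdjMinusV G (a ∷ []))

    ∉[a] : ∀ {x} → x ≢ a → x ∉ a ∷ []
    ∉[a] x≢a (here eq) = x≢a eq
    ∉[a] x≢a (there ())

    edge : ∀ {x y} → x ≢ a → y ≢ a → G x y → x ⇝ y
    edge x≢a y≢a e = edgeʷ (∉[a] x≢a , ∉[a] y≢a , e)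

    ⇝-sym : ∀ {x y} → x ⇝ y → y ⇝ x
    ⇝-sym = reverseʷ λ {x} {y} (x∉ , y∉ , e) → y∉ , x∉ , G-sym {x} {y} e

    cube-walk : ∀ {b u v} → (∀ {x} → Cube b x → x ≢ a) → Cube b u → Cube b v → u ⇝ v
    cube-walk {b} {u} {v} avoid cu cv = flips-walk _ middle? (Cube b) flip-step cu agree
      where
      flip-step : ∀ {x r} → Cube b x → Middle r → Cube b (flip x r) × AdjMinusV G (a ∷ []) x (flip x r)
      flip-step {x} cx mid = middle-flip-cube mid cx , ∉[a] (avoid cx) , ∉[a] (avoid (middle-flip-cube mid cx))
                           , middle-adj x mid (Cube.bit₀ cx)

      agree : ∀ r → ¬ Middle r → lookup u r ≡ lookup v r
      agree r ¬mid with not-middle r ¬mid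
      ... | inj₁ refl = trans (Cube.bit₀ cu) (sym (Cube.bit₀ cv))
      ... | inj₂ refl = trans (Cube.bitL cu) (sym (Cube.bitL cv))

    rung : ∀ {y} → lookup y i0 ≡ true → lookup y i1 ≢ lookup a i1 → y ⇝ across y
    rung {y} y₀ y₁≢a₁ =
      edge (off y refl) (off y′ y′₁) (flip₀-adj y) ++ʷ
      edge (off y′ y′₁) (off y″ y″₁) (flipL-adj y′ (trans (lookup-flip y i0) (cong not y₀))) ++ʷ
      edge (off y″ y″₁) (off _ (trans (lookup-flip′ y″ (λ ())) y″₁)) (flip₀-adj y″)
      where
      y′ y″ : V
      y′ = flip y i0
      y″ = flip y′ iL

      off : ∀ x → lookup x i1 ≡ lookup y i1 → x ≢ a
      off x eq = ≢-at i1 (λ x₁≡a₁ → y₁≢a₁ (trans (sym eq) x₁≡a₁))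

      y′₁ : lookup y′ i1 ≡ lookup y i1
      y′₁ = lookup-flip′ y (λ ())

      y″₁ : lookup y″ i1 ≡ lookup y i1
      y″₁ = trans (lookup-flip′ y′ (λ ())) y′₁

    module OnCubeSide (a₀ : lookup a i0 ≡ true) where

      b : Bool
      b = not (lookup a iL)

      outside : ∀ {x} → Cube b x → x ≢ a
      outside (cube _ xL) = ≢-at iL (λ eq → not-¬ refl (sym (trans (sym xL) eq)))

      matching-side≢ : ∀ x → lookup x i0 ≡ false → x ≢ a
      matching-side≢ x x₀ = ≢-at i0 (λ eq → false≢true (trans (sym x₀) (trans eq a₀)))

      hub : V
      hub = flip a iL

      to-hub : ∀ {w} → Cube b w → w ⇝ hub
      to-hub cw = cube-walk outside cw (cube (trans (lookup-flip′ a (λ ())) a₀) (lookup-flip a iL))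

      enter : ∀ {w} → lookup w i0 ≡ false → lookup w iL ≡ b → w ⇝ hub
      enter {w} w₀ wL = edge (matching-side≢ w w₀) (outside cw′) (flip₀-adj w) ++ʷ to-hub cw′
        where
        cw′ : Cube b (flip w i0)
        cw′ = subst (λ β → Cube β (flip w i0)) wL (flip₀-cube w w₀)

      from-matching-side : ∀ {w} → lookup w i0 ≡ false → w ⇝ hub
      from-matching-side {w} w₀ with lookup w iL ≟ᵇ b
      ... | yes wL  = enter w₀ wL
      ... | no wL≢b =
        edge (matching-side≢ w w₀) (matching-side≢ (flip w iL) w′₀) (flipL-adj w w₀) ++ʷ
        enter w′₀ (trans (lookup-flip w iL) (sym (¬-not (wL≢b ∘ sym))))
        where
        w′₀ : lookup (flip w iL) i0 ≡ false
        w′₀ = trans (lookup-flip′ w (λ ())) w₀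

      reach : ∀ w → w ≢ a → w ⇝ hub
      reach w w≢a with bit0-cases w
      ... | inj₂ w₀ = from-matching-side w₀
      ... | inj₁ w₀ with lookup w iL ≟ᵇ b
      ...   | yes wL = to-hub (cube w₀ wL)
      ...   | no _   = edge w≢a (matching-side≢ (flip w i0) w′₀) (flip₀-adj w) ++ʷ from-matching-side w′₀
        where
        w′₀ : lookup (flip w i0) i0 ≡ false
        w′₀ = trans (lookup-flip w i0) (cong not w₀)

    module OnMatchingSide (a₀ : lookup a i0 ≡ false) where

      cube-side≢ : ∀ x → lookup x i0 ≡ true → x ≢ a
      cube-side≢ x x₀ = ≢-at i0 (λ eq → false≢true (trans (sym a₀) (trans (sym eq) x₀)))

      avoid : ∀ {b x} → Cube b x → x ≢ a
      avoid {x = x} cx = cube-side≢ x (Cube.bit₀ cx)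

      hub : V
      hub = flip a i0

      cube-hub : Cube (lookup a iL) hub
      cube-hub = flip₀-cube a a₀

      -- Its bit 1 differs from a's, so its rung misses a.
      y : V
      y = flip hub i1

      y₁≢a₁ : lookup y i1 ≢ lookup a i1
      y₁≢a₁ eq = not-¬ refl (trans (sym eq) (trans (lookup-flip hub i1) (cong not (lookup-flip′ a (λ ())))))

      from-cube-side : ∀ {w} → lookup w i0 ≡ true → w ⇝ hub
      from-cube-side {w} w₀ with lookup w iL ≟ᵇ lookup a iL
      ... | yes wL  = cube-walk avoid (cube w₀ wL) cube-hub
      ... | no wL≢a = ⇝-sym
        (cube-walk avoid cube-hub cube-y ++ʷ
         rung (Cube.bit₀ cube-y) y₁≢a₁ ++ʷ
         cube-walk avoid (across-cube cube-y) (cube w₀ (¬-not wL≢a)))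
        where
        cube-y : Cube (lookup a iL) y
        cube-y = middle-flip-cube middle-i1 cube-hub

      reach : ∀ w → w ≢ a → w ⇝ hub
      reach w w≢a with bit0-cases w
      ... | inj₁ w₀ = from-cube-side w₀
      ... | inj₂ w₀ = edge w≢a (cube-side≢ (flip w i0) w′₀) (flip₀-adj w) ++ʷ from-cube-side w′₀
        where
        w′₀ : lookup (flip w i0) i0 ≡ true
        w′₀ = trans (lookup-flip w i0) (cong not w₀)

    hub-reachable : Σ V λ h → ∀ w → w ≢ a → w ⇝ h
    hub-reachable with bit0-cases a
    ... | inj₁ a₀ = OnCubeSide.hub a₀ , OnCubeSide.reach a₀
    ... | inj₂ a₀ = OnMatchingSide.hub a₀ , OnMatchingSide.reach a₀

  connected-minus-vertex : ∀ a {u v} → u ≢ a → v ≢ a → Walk (AdjMinusV G (a ∷ [])) u v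
  connected-minus-vertex a {u} {v} u≢a v≢a = reach u u≢a ++ʷ ⇝-sym (reach v v≢a)
    where
    open Avoiding a

    reach : ∀ w → w ≢ a → w ⇝ proj₁ hub-reachable
    reach = proj₂ hub-reachable

  x₀ x₀′ : V
  x₀  = replicate _ false
  x₀′ = flip x₀ iL

  -- The edge {x₀, x₀′} of the u₀ = 0 side, attached to the rest only by its two bit-0 edges.
  Island : V → Set
  Island u = u ≡ x₀ ⊎ u ≡ x₀′

  island-bit : ∀ {u} j → j ≢ iL → Island u → lookup u j ≡ false
  island-bit j _    (inj₁ refl) = lookup-replicate j false
  island-bit j j≢iL (inj₂ refl) = trans (lookup-flip′ x₀ j≢iL) (lookup-replicate j false)

  exit-bit0 : ∀ {u} → Island u → lookup (flip u i0) i0 ≡ true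
  exit-bit0 {u} iu = trans (lookup-flip u i0) (cong not (island-bit i0 (λ ()) iu))

  island-exit : ∀ {u w} → Island u → G u w → Island w ⊎ w ≡ flip u i0
  island-exit iu e with matching-side-neighbours (island-bit i0 (λ ()) iu) e | iu
  ... | inj₁ w≡u₀ | _         = inj₂ w≡u₀
  ... | inj₂ refl | inj₁ refl = inj₁ (inj₂ refl)
  ... | inj₂ refl | inj₂ refl = inj₁ (inj₁ (flip-involutive x₀ iL))

  x₀-bit0 : lookup x₀ i0 ≡ false
  x₀-bit0 = lookup-replicate i0 false

  far : V
  far = flip x₀ i1

  far-bit0 : lookup far i0 ≡ false
  far-bit0 = trans (lookup-flip′ x₀ {i0} {i1} (λ ())) (lookup-replicate i0 false)

  far∉island : ¬ Island far
  far∉island i = false≢true (trans (sym (island-bit i1 (λ ()) i)) far-bit1)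
    where
    far-bit1 : lookup far i1 ≡ true
    far-bit1 = trans (lookup-flip x₀ i1) (cong not (lookup-replicate i1 false))

  S : List V
  S = flip x₀ i0 ∷ flip x₀′ i0 ∷ []

  ∈S⇒bit0 : ∀ {x} → x ∈ S → lookup x i0 ≡ true
  ∈S⇒bit0 (here refl)         = exit-bit0 (inj₁ refl)
  ∈S⇒bit0 (there (here refl)) = exit-bit0 (inj₂ refl)

  ∉S : ∀ x → lookup x i0 ≡ false → x ∉ S
  ∉S x x₀ x∈S = false≢true (trans (sym x₀) (∈S⇒bit0 x∈S))

  exit∈S : ∀ {u} → Island u → flip u i0 ∈ S
  exit∈S (inj₁ refl) = here refl
  exit∈S (inj₂ refl) = there (here refl)

  vertex-cut : Is1VertexCut G S
  vertex-cut = (exits-distinct ∷ []) ∷ [] ∷ []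
             , (x₀ , far , ∉S x₀ x₀-bit0 , ∉S far far-bit0
               , λ walk → far∉island (walk-preserves Island stays walk (inj₁ refl)))
             , min-degree
    where
    exits-distinct : flip x₀ i0 ≢ flip x₀′ i0
    exits-distinct = ≢-at iL λ eq → false≢true
      (trans (sym (trans (lookup-flip′ x₀ {iL} {i0} (λ ())) (lookup-replicate iL false)))
             (trans eq (trans (lookup-flip′ x₀′ {iL} {i0} (λ ())) (trans (lookup-flip x₀ iL) (cong not (lookup-replicate iL false))))))

    stays : ∀ {u w} → Island u → AdjMinusV G S u w → Island w
    stays iu (_ , w∉S , e) with island-exit iu e
    ... | inj₁ iw   = iw
    ... | inj₂ refl = ⊥-elim (w∉S (exit∈S iu))

    min-degree : ∀ u → u ∉ S → Σ V λ w → AdjMinusV G S u w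
    min-degree u u∉S with bit0-cases u
    ... | inj₁ u₀ = flip u i0 , u∉S , ∉S _ (trans (lookup-flip u i0) (cong not u₀)) , flip₀-adj u
    ... | inj₂ u₀ = flip u iL , u∉S , ∉S _ (trans (lookup-flip′ u (λ ())) u₀) , flipL-adj u u₀

  F : List (V × V)
  F = (x₀ , flip x₀ i0) ∷ (x₀′ , flip x₀′ i0) ∷ []

  ∈F⇒bit0 : ∀ {p q} → (p , q) ∈ F → lookup p i0 ≡ false × lookup q i0 ≡ true
  ∈F⇒bit0 (here refl)         = x₀-bit0 , exit-bit0 (inj₁ refl)
  ∈F⇒bit0 (there (here refl)) = island-bit i0 (λ ()) (inj₂ refl) , exit-bit0 (inj₂ refl)

  exit∈F : ∀ {u} → Island u → (u , flip u i0) ∈ F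
  exit∈F (inj₁ refl) = here refl
  exit∈F (inj₂ refl) = there (here refl)

  edge-cut : Is1EdgeCut G F
  edge-cut = flip₀-adj x₀ ∷ flip₀-adj x₀′ ∷ []
           , (cut-edges-distinct ∷ []) ∷ [] ∷ []
           , (x₀ , far , λ walk → far∉island (walk-preserves Island stays walk (inj₁ refl)))
           , min-degree
    where
    cut-edges-distinct : DistinctEdges (x₀ , flip x₀ i0) (x₀′ , flip x₀′ i0)
    cut-edges-distinct = (λ (eq , _) → flip-≢ x₀ iL (sym eq)) , (λ (eq , _) → ∉S x₀ x₀-bit0 (there (here eq)))

    stays : ∀ {u w} → Island u → AdjMinusE G F u w → Island w
    stays iu (e , uw∉F , _) with island-exit iu e
    ... | inj₁ iw   = iw
    ... | inj₂ refl = ⊥-elim (uw∉F (exit∈F iu))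

    starts-bit0 : ∀ {p q} → lookup p i0 ≡ true → (p , q) ∉ F
    starts-bit0 p₀ pq∈F = false≢true (trans (sym (proj₁ (∈F⇒bit0 pq∈F))) p₀)

    ends-bit0 : ∀ {p q} → lookup q i0 ≡ false → (p , q) ∉ F
    ends-bit0 q₀ pq∈F = false≢true (trans (sym q₀) (proj₂ (∈F⇒bit0 pq∈F)))

    min-degree : ∀ u → Σ V λ w → AdjMinusE G F u w
    min-degree u with bit0-cases u
    ... | inj₁ u₀ = flip u i1 , middle-adj u middle-i1 u₀
                  , starts-bit0 u₀ , starts-bit0 (trans (lookup-flip′ u (λ ())) u₀)
    ... | inj₂ u₀ = flip u iL , flipL-adj u u₀
                  , ends-bit0 (trans (lookup-flip′ u (λ ())) u₀) , ends-bit0 u₀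

corollary3p2 : (t : ℕ) → 1 ≤ t → Kappa1≡ (EHAdj 1 t) 2 × Lambda1≡ (EHAdj 1 t) 2
corollary3p2 (suc m) _ = ((S , vertex-cut , refl) , 1-vertex-cut-size)
                       , ((F , edge-cut , refl) , 1-edge-cut-size)
  where
  open EH₁ m
  open TwoConnected G (≡-dec _≟ᵇ_) (λ {u} {v} → G-sym {u} {v}) G-irrefl two-neighbours connected-minus-vertex
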